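{- \[ \lim_{q\to\infty}\frac{m_{\frac1q}}{m_{\frac1{q-1}}}=\frac{5+\sqrt{21}}{2}. \]
   Context: Generalized Markov numbers $m_{\frac pq}$ for reduced $\tfrac pq\in(0,1]$. Start from three positions with labels $\tfrac01,\tfrac10,\tfrac{ -1}1$, each carrying the number $1$. Mutating a position with label $\tfrac ef$ and number $z$, where the other two positions have labels $\tfrac ab,\tfrac cd$ and numbers $x,y$, does two things. It replaces the label by $\tfrac{a+c}{b+d}$, or by $\tfrac{c-a}{d-b}$ if $\tfrac ef=\tfrac{a+c}{b+d}$. It replaces $z$ by $(x^2+xy+y^2)/z$. Consider mutation sequences starting with position $\tfrac{ -1}1$, then $\tfrac10$, never mutating the same position twice in a row. Every reduced $\tfrac pq\in(0,1]$ occurs as a label, always carrying the same number $m_{\frac pq}$. The resulting triples are positive integer solutions of $x^2+y^2+z^2+xy+xz+yz=6xyz$. For example $m_{\frac11}=3$, $m_{\frac12}=13$, $m_{\frac13}=61$, $m_{\frac14}=291$. -}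

module Defs where

open import Data.Nat as ℕ using (ℕ; suc; _≤_)
open import Data.Integer as ℤ using (ℤ; +_; -[1+_])
open import Data.Fin using (Fin; zero; suc)
import Data.Fin
import Data.Product
open import Data.Product using (Σ; ∃; _×_; _,_)
open import Data.Sum using (_⊎_)
open import Relation.Nullary using (yes; no; ¬_)
open import Relation.Binary.PropositionalEquality using (_≡_)
open import Data.Rational as ℚ using (ℚ; _<_; _/_)

-- A label e/f is stored as a pair (numerator , denominator) of integers;
-- labels are compared as fractions via cross multiplication.
record Pos : Set where
  constructor pos
  field
    num : ℤ
    den : ℤ
    val : ℕ

State : Set
State = Fin 3 → Pos

initial : State
initial zero = pos (+ 0) (+ 1) 1
initial (suc zero) = pos (+ 1) (+ 0) 1
initial (suc (suc zero)) = pos -[1+ 0 ] (+ 1) 1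

other₁ other₂ : Fin 3 → Fin 3
other₁ zero = suc zero
other₁ (suc zero) = zero
other₁ (suc (suc zero)) = zero
other₂ zero = suc (suc zero)
other₂ (suc zero) = suc (suc zero)
other₂ (suc (suc zero)) = suc zero

newLabel : (a b c d e f : ℤ) → ℤ × ℤ
newLabel a b c d e f with e ℤ.* (b ℤ.+ d) ℤ.≟ f ℤ.* (a ℤ.+ c)
... | yes _ = (c ℤ.- a , d ℤ.- b)
... | no _  = (a ℤ.+ c , b ℤ.+ d)

update : State → Fin 3 → Pos → State
update s i p k with k Data.Fin.≟ i
... | yes _ = p
... | no _  = s k

-- Mut i s s' : s' is obtained from s by mutating position i.
-- The new number z' is the (exact) quotient (x² + xy + y²)/z, expressed as z' * z ≡ x² + xy + y².
data Mut (i : Fin 3) (s : State) : State → Set where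
  mut : (z' : ℕ) →
        let open Pos in
        let x = val (s (other₁ i)) ; y = val (s (other₂ i)) ; z = val (s i) in
        z' ℕ.* z ≡ x ℕ.* x ℕ.+ x ℕ.* y ℕ.+ y ℕ.* y →
        Mut i s (update s i
          (let L = newLabel (num (s (other₁ i))) (den (s (other₁ i)))
                            (num (s (other₂ i))) (den (s (other₂ i)))
                            (num (s i)) (den (s i))
           in pos (Data.Product.proj₁ L) (Data.Product.proj₂ L) z'))

data Reach₂ : Fin 3 → State → Set where
  second : ∀ {s₁ s₂} → Mut (suc (suc zero)) initial s₁ → Mut (suc zero) s₁ s₂ →
           Reach₂ (suc zero) s₂
  step   : ∀ {i j s s'} → Reach₂ i s → ¬ (j ≡ i) → Mut j s s' → Reach₂ j s'

Carries : State → ℕ → ℕ → ℕ → Set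
Carries s p q n = ∃ λ k → (Pos.num (s k) ℤ.* + q ≡ Pos.den (s k) ℤ.* + p) × Pos.val (s k) ≡ n

IsMarkov : ℕ → ℕ → ℕ → Set
IsMarkov p q n =
  (∃ λ s → Mut (suc (suc zero)) initial s × Carries s p q n)
  ⊎ (∃ λ i → ∃ λ s → Reach₂ i s × Carries s p q n)

-- comparisons of a rational r with α = (5 + √21)/2, i.e. 2r - 5 against √21
ℚ2 ℚ5 ℚ21 : ℚ
ℚ2 = + 2 / 1
ℚ5 = + 5 / 1
ℚ21 = + 21 / 1

BelowAlpha : ℚ → Set
BelowAlpha r = let t = ℚ2 ℚ.* r ℚ.- ℚ5 in (t < ℚ.0ℚ) ⊎ (t ℚ.* t < ℚ21)

AboveAlpha : ℚ → Set
AboveAlpha r = let t = ℚ2 ℚ.* r ℚ.- ℚ5 in (ℚ.0ℚ ℚ.≤ t) × (ℚ21 < t ℚ.* t)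

fromℕ : ℕ → ℚ
fromℕ n = + n / 1

-- After the first mutation the three labels always form a Farey triple: the last mutated
-- label is the mediant of the other two, and those two have determinant ±1.  Hence the
-- mutation rule only ever takes mediants, and a label 1/q can only be created from 1/(q-2)
-- with neighbours 0/1 and 1/(q-1).  So m_{1/q} is the sequence m₁ with
-- m₁ (q + 2) · m₁ q = m₁ (q + 1)² + m₁ (q + 1) + 1, i.e. every (1, m₁ q, m₁ (q + 1)) solves
-- the Markov-type equation.  For a = m₁ q and b = m₁ (q + 1) this reads
-- (2b − 5a)² + 4(1 + a + b) = 21a², so 2b/a − 5 approaches √21 from below with defect
-- O(1/a), and b/a tends to α = (5 + √21)/2.

module Submission where

open import Defs
open import Data.Nat using (ℕ; zero; suc; pred; _+_; _*_; _∸_; _≤_; _<_; _<?_; z≤n; s≤s; NonZero; >-nonZero⁻¹)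
open import Data.Nat.Properties hiding (_≟_)
open import Data.Nat.Divisibility using (_∣_; ∣1⇒≡1; ∣m+n∣m⇒∣n; m∣m*n)
open import Data.Nat.Tactic.RingSolver using (solve-∀)
open import Data.Integer as ℤ using (ℤ; +_; -[1+_]; 0ℤ)
import Data.Integer.Properties as ℤ
open import Data.Integer.Tactic.RingSolver renaming (solve-∀ to ℤ-solve-∀)
open import Data.Rational as ℚ using (ℚ; mkℚ; toℚᵘ; ↥_; ↧_; ↧ₙ_)
import Data.Rational.Properties as ℚ
open import Data.Rational.Unnormalised as ℚᵘ using (ℚᵘ; mkℚᵘ; *≡*; *<*) renaming (_≃_ to _≃ᵘ_)
import Data.Rational.Unnormalised.Properties as ℚᵘ
open import Data.Fin using (Fin; zero; suc; _≟_)
open import Data.Vec.Functional using (updateAt)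
open import Data.Vec.Functional.Properties using (updateAt-updates; updateAt-minimal)
open import Data.Product using (∃; _×_; _,_; proj₁; proj₂)
open import Data.Sum using (_⊎_; inj₁; inj₂)
open import Data.Empty using (⊥-elim)
open import Function using (_∘_; const)
open import Relation.Nullary using (¬_; yes; no; contradiction)
open import Relation.Binary.PropositionalEquality
open Pos

-- The sequence m_{1/q}

-- pred-gap q = (m₁ q − 1 , m₁ (q + 1) − m₁ q); tracking these keeps the recurrence
-- m₁ (q + 2) = 5 m₁ (q + 1) − m₁ q − 1 free of truncated subtraction.
pred-gap : ℕ → ℕ × ℕ
pred-gap zero    = 0 , 2
pred-gap (suc q) = let (p , g) = pred-gap q in p + g , 3 * (p + g) + g + 2

m₁ gap : ℕ → ℕ
m₁ q  = suc (proj₁ (pred-gap q))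
gap q = proj₂ (pred-gap q)

-- (1, a, b) solves x² + y² + z² + xy + xz + yz = 6xyz.
MarkovPair : ℕ → ℕ → Set
MarkovPair a b = a * a + b * b + 1 + a + b ≡ 5 * (a * b)

m₁-markovPair : ∀ q → MarkovPair (m₁ q) (m₁ (suc q))
m₁-markovPair zero    = refl
m₁-markovPair (suc q) = +-cancelʳ-≡ (5 * (a * b)) _ _ (begin
    (b * b + c * c + 1 + b + c) + 5 * (a * b) ≡⟨ vieta (proj₁ (pred-gap q)) (gap q) ⟩
    (a * a + b * b + 1 + a + b) + 5 * (b * c) ≡⟨ cong (_+ 5 * (b * c)) (m₁-markovPair q) ⟩
    5 * (a * b) + 5 * (b * c)                 ≡⟨ +-comm (5 * (a * b)) _ ⟩
    5 * (b * c) + 5 * (a * b)                 ∎)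
  where
  open ≡-Reasoning
  a b c : ℕ
  a = m₁ q
  b = m₁ (suc q)
  c = m₁ (suc (suc q))
  vieta : ∀ p g → let a = suc p ; b = suc (p + g) ; c = suc (p + g + (3 * (p + g) + g + 2)) in
    (b * b + c * c + 1 + b + c) + 5 * (a * b) ≡ (a * a + b * b + 1 + a + b) + 5 * (b * c)
  vieta = solve-∀

m₁-exchange : ∀ q → m₁ (suc (suc q)) * m₁ q ≡ m₁ (suc q) * m₁ (suc q) + m₁ (suc q) * 1 + 1 * 1
m₁-exchange q = +-cancelʳ-≡ (a * a + a) _ _ (begin
    c * a + (a * a + a)               ≡⟨ vieta (proj₁ (pred-gap q)) (gap q) ⟩
    5 * (a * b)                       ≡⟨ m₁-markovPair q ⟨
    a * a + b * b + 1 + a + b         ≡⟨ regroup a b ⟩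
    b * b + b * 1 + 1 * 1 + (a * a + a) ∎)
  where
  open ≡-Reasoning
  a b c : ℕ
  a = m₁ q
  b = m₁ (suc q)
  c = m₁ (suc (suc q))
  vieta : ∀ p g → let a = suc p ; b = suc (p + g) ; c = suc (p + g + (3 * (p + g) + g + 2)) in
    c * a + (a * a + a) ≡ 5 * (a * b)
  vieta = solve-∀
  regroup : ∀ a b → a * a + b * b + 1 + a + b ≡ b * b + b * 1 + 1 * 1 + (a * a + a)
  regroup = solve-∀

2*m₁≤gap : ∀ q → 2 * m₁ q ≤ gap q
2*m₁≤gap zero    = ≤-refl
2*m₁≤gap (suc q) = ≤-trans (m≤m+n _ _) (≤-reflexive (lemma (proj₁ (pred-gap q)) (gap q)))
  where
  lemma : ∀ p g → 2 * suc (p + g) + (p + 2 * g) ≡ 3 * (p + g) + g + 2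
  lemma = solve-∀

m₁-ratio≥5/2 : ∀ q → 5 * m₁ q ≤ 2 * m₁ (suc q)
m₁-ratio≥5/2 q = begin
  5 * m₁ q              ≤⟨ m≤m+n (5 * m₁ q) (m₁ q) ⟩
  5 * m₁ q + m₁ q       ≡⟨ lemma (m₁ q) ⟩
  2 * (m₁ q + 2 * m₁ q) ≤⟨ *-monoʳ-≤ 2 (+-monoʳ-≤ (m₁ q) (2*m₁≤gap q)) ⟩
  2 * m₁ (suc q)        ∎
  where
  open ≤-Reasoning
  lemma : ∀ a → 5 * a + a ≡ 2 * (a + 2 * a)
  lemma = solve-∀

q<m₁ : ∀ q → q < m₁ q
q<m₁ zero    = s≤s z≤n
q<m₁ (suc q) = ≤-<-trans (q<m₁ q) (m<m+n (m₁ q) (<-≤-trans (s≤s z≤n) (2*m₁≤gap q)))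

-- Farey triples of labels

Label : Set
Label = ℕ × ℕ

infixl 6 _⊕_

_⊕_ : Label → Label → Label
(a , b) ⊕ (c , d) = a + c , b + d

⊕-comm : ∀ P Q → P ⊕ Q ≡ Q ⊕ P
⊕-comm (a , b) (c , d) = cong₂ _,_ (+-comm a c) (+-comm b d)

SameRatio : Label → Label → Set
SameRatio (a , b) (c , d) = a * d ≡ b * c

data Unimodular : Label → Label → Set where
  det≡1  : ∀ {a b c d} → a * d ≡ suc (b * c) → Unimodular (a , b) (c , d)
  det≡-1 : ∀ {a b c d} → b * c ≡ suc (a * d) → Unimodular (a , b) (c , d)

unimodular-sym : ∀ {P Q} → Unimodular P Q → Unimodular Q P
unimodular-sym (det≡1 {a} {b} {c} {d} e)  = det≡-1 (subst₂ (λ x y → x ≡ suc y) (*-comm a d) (*-comm b c) e)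
unimodular-sym (det≡-1 {a} {b} {c} {d} e) = det≡1 (subst₂ (λ x y → x ≡ suc y) (*-comm b c) (*-comm a d) e)

unimodular-⊕ˡ : ∀ {X Q} → Unimodular X Q → Unimodular (X ⊕ Q) Q
unimodular-⊕ˡ (det≡1 {a} {b} {c} {d} e) = det≡1 (begin
  (a + c) * d         ≡⟨ *-distribʳ-+ d a c ⟩
  a * d + c * d       ≡⟨ cong (_+ c * d) e ⟩
  suc (b * c + c * d) ≡⟨ cong (λ x → suc (b * c + x)) (*-comm c d) ⟩
  suc (b * c + d * c) ≡⟨ cong suc (*-distribʳ-+ c b d) ⟨
  suc ((b + d) * c)   ∎)
  where open ≡-Reasoning
unimodular-⊕ˡ (det≡-1 {a} {b} {c} {d} e) = det≡-1 (begin
  (b + d) * c         ≡⟨ *-distribʳ-+ c b d ⟩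
  b * c + d * c       ≡⟨ cong (_+ d * c) e ⟩
  suc (a * d + d * c) ≡⟨ cong (λ x → suc (a * d + x)) (*-comm d c) ⟩
  suc (a * d + c * d) ≡⟨ cong suc (*-distribʳ-+ d a c) ⟨
  suc ((a + c) * d)   ∎)
  where open ≡-Reasoning

¬unimodular-0-0 : ∀ {b d} → ¬ Unimodular (0 , b) (0 , d)
¬unimodular-0-0 (det≡-1 {b = b} e) = 0≢1+n (trans (sym (*-zeroʳ b)) e)

unimodular-1-0 : ∀ {b d} → Unimodular (1 , b) (0 , d) → d ≡ 1
unimodular-1-0 (det≡1 {b = b} {d = d} e) = begin
  d           ≡⟨ +-identityʳ d ⟨
  1 * d       ≡⟨ e ⟩
  suc (b * 0) ≡⟨ cong suc (*-zeroʳ b) ⟩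
  1           ∎
  where open ≡-Reasoning
unimodular-1-0 (det≡-1 {b = b} e) = ⊥-elim (0≢1+n (trans (sym (*-zeroʳ b)) e))

unimodular⇒¬sameRatio : ∀ {P Q} → Unimodular P Q → ¬ SameRatio P Q
unimodular⇒¬sameRatio (det≡1 {b = b} {c} e) s =
  m≢1+m+n (b * c) (trans (sym s) (trans e (cong suc (sym (+-identityʳ _)))))
unimodular⇒¬sameRatio (det≡-1 {a} {d = d} e) s =
  m≢1+m+n (a * d) (trans s (trans e (cong suc (sym (+-identityʳ _)))))

a∣a*q*c : ∀ a q c → a ∣ a * q * c
a∣a*q*c a q c = subst (a ∣_) (sym (*-assoc a q c)) (m∣m*n (q * c))

unimodular⇒numerator-1 : ∀ {a q b L} → a * q ≡ b → Unimodular (a , b) L → a ≡ 1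
unimodular⇒numerator-1 {a} {q} refl (det≡1 {c = c} {d} e) =
  ∣1⇒≡1 (∣m+n∣m⇒∣n (subst (a ∣_) (trans e (+-comm 1 _)) (m∣m*n d)) (a∣a*q*c a q c))
unimodular⇒numerator-1 {a} {q} refl (det≡-1 {c = c} {d} e) =
  ∣1⇒≡1 (∣m+n∣m⇒∣n (subst (a ∣_) (trans e (+-comm 1 _)) (a∣a*q*c a q c)) (m∣m*n d))

sameRatio-⊕⊕ : ∀ X Q → SameRatio X (X ⊕ Q ⊕ Q) → SameRatio X Q
sameRatio-⊕⊕ (e , f) (c , d) s =
  *-cancelˡ-≡ (e * d) (f * c) 2 (+-cancelˡ-≡ (e * f) (2 * (e * d)) (2 * (f * c)) (begin
  e * f + 2 * (e * d)   ≡⟨ expand e f d ⟩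
  e * (f + d + d)       ≡⟨ s ⟩
  f * (e + c + c)       ≡⟨ expand f e c ⟨
  f * e + 2 * (f * c)   ≡⟨ cong (_+ 2 * (f * c)) (*-comm f e) ⟩
  e * f + 2 * (f * c)   ∎))
  where
  open ≡-Reasoning
  expand : ∀ x y z → x * y + 2 * (x * z) ≡ x * (y + z + z)
  expand = solve-∀

Neighbours : Label → Label → Label → Set
Neighbours X P Q = (P ≡ X ⊕ Q × Unimodular X Q) ⊎ (Q ≡ X ⊕ P × Unimodular X P)

neighbours-unimodular : ∀ {X P Q} → Neighbours X P Q → Unimodular P Q
neighbours-unimodular (inj₁ (refl , u)) = unimodular-⊕ˡ u
neighbours-unimodular (inj₂ (refl , u)) = unimodular-sym (unimodular-⊕ˡ u)

neighbours-¬sameRatio : ∀ {X P Q} → Neighbours X P Q → ¬ SameRatio X (P ⊕ Q)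
neighbours-¬sameRatio {X} {Q = Q} (inj₁ (refl , u)) =
  unimodular⇒¬sameRatio u ∘ sameRatio-⊕⊕ X Q
neighbours-¬sameRatio {X} {P} (inj₂ (refl , u)) =
  unimodular⇒¬sameRatio u ∘ sameRatio-⊕⊕ X P ∘ subst (SameRatio X) (⊕-comm P (X ⊕ P))

record HasNumber (L : Label) (z : ℕ) : Set where
  field
    number-0/1 : L ≡ (0 , 1) → z ≡ 1
    number-1/q : ∀ q → L ≡ (1 , q) → z ≡ m₁ q

open HasNumber

has-number-0/1 : HasNumber (0 , 1) 1
has-number-0/1 = record { number-0/1 = λ _ → refl ; number-1/q = λ _ () }

has-number-1/q : ∀ {q z} → z ≡ m₁ q → HasNumber (1 , q) z
has-number-1/q z≡m₁q = record { number-0/1 = λ () ; number-1/q = λ { _ refl → z≡m₁q } }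

mediant-numerator-1 : ∀ x c → x + c + c ≡ 1 → x ≡ 1 × c ≡ 0
mediant-numerator-1 x zero    e = trans (sym (trans (+-identityʳ (x + 0)) (+-identityʳ x))) e , refl
mediant-numerator-1 x (suc c) e = ⊥-elim (1+n≢0 (m+n≡0⇒n≡0 (x + c) (suc-injective (begin
  suc (x + c + suc c)   ≡⟨ cong (_+ suc c) (+-suc x c) ⟨
  x + suc c + suc c     ≡⟨ e ⟩
  1                     ∎))))
  where open ≡-Reasoning

ladder : ∀ {X Q q} → Unimodular X Q → X ⊕ Q ⊕ Q ≡ (1 , q) →
         ∃ λ d → X ≡ (1 , d) × Q ≡ (0 , 1) × q ≡ suc (suc d)
ladder {x₁ , d} {c₁ , c₂} u e with mediant-numerator-1 x₁ c₁ (cong proj₁ e)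
... | refl , refl with unimodular-1-0 u
... | refl = d , refl , refl , trans (sym (cong proj₂ e)) (lemma d)
  where
  lemma : ∀ d → d + 1 + 1 ≡ suc (suc d)
  lemma = solve-∀

mediant-number : ∀ {X Q x y z z'} → Unimodular X Q →
  HasNumber (X ⊕ Q) x → HasNumber Q y → HasNumber X z → z' * z ≡ x * x + x * y + y * y →
  HasNumber (X ⊕ Q ⊕ Q) z'
mediant-number {x₁ , x₂} {c₁ , c₂} u _ _ _ _ .number-0/1 e =
  ⊥-elim (¬unimodular-0-0 (subst₂ Unimodular (cong (_, x₂) x₁≡0) (cong (_, c₂) c₁≡0) u))
  where
  x₁≡0 : x₁ ≡ 0
  x₁≡0 = m+n≡0⇒m≡0 x₁ (m+n≡0⇒m≡0 (x₁ + c₁) (cong proj₁ e))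
  c₁≡0 : c₁ ≡ 0
  c₁≡0 = m+n≡0⇒n≡0 (x₁ + c₁) (cong proj₁ e)
mediant-number {z' = z'} u nP nQ nX eq .number-1/q q e with ladder u e
... | d , refl , refl , refl
  with number-1/q nP (suc d) (cong (1 ,_) (+-comm d 1)) | number-0/1 nQ refl | number-1/q nX d refl
... | refl | refl | refl = *-cancelʳ-≡ z' (m₁ (suc (suc d))) (m₁ d) (trans eq (sym (m₁-exchange d)))

neighbours-number : ∀ {X P Q x y z z'} → Neighbours X P Q →
  HasNumber P x → HasNumber Q y → HasNumber X z → z' * z ≡ x * x + x * y + y * y →
  HasNumber (P ⊕ Q) z'
neighbours-number (inj₁ (refl , u)) nP nQ nX eq = mediant-number u nP nQ nX eq
neighbours-number {X} {P} {x = x} {y} {z' = z'} (inj₂ (refl , u)) nP nQ nX eq =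
  subst (λ L → HasNumber L z') (⊕-comm (X ⊕ P) P) (mediant-number u nQ nP nX (trans eq (swap x y)))
  where
  swap : ∀ x y → x * x + x * y + y * y ≡ y * y + y * x + x * x
  swap = solve-∀

HasLabel : Pos → Label → Set
HasLabel p (a , b) = (num p , den p) ≡ (+ a , + b)

Marked : Pos → Label → Set
Marked p L = HasLabel p L × HasNumber L (val p)

mutated : State → Fin 3 → ℕ → Pos
mutated s i z =
  let L = newLabel (num (s (other₁ i))) (den (s (other₁ i)))
                   (num (s (other₂ i))) (den (s (other₂ i))) (num (s i)) (den (s i))
  in pos (proj₁ L) (proj₂ L) z

newLabel-mediant : ∀ a b c d e f → ¬ SameRatio (e , f) ((a , b) ⊕ (c , d)) →
  newLabel (+ a) (+ b) (+ c) (+ d) (+ e) (+ f) ≡ (+ (a + c) , + (b + d))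
newLabel-mediant a b c d e f ¬same with + e ℤ.* (+ b ℤ.+ + d) ℤ.≟ + f ℤ.* (+ a ℤ.+ + c)
... | yes h = ⊥-elim (¬same (ℤ.+-injective (trans (ℤ.pos-* e (b + d)) (trans h (sym (ℤ.pos-* f (a + c)))))))
... | no _  = refl

mutated-label : ∀ {s} i P Q X z →
  HasLabel (s (other₁ i)) P → HasLabel (s (other₂ i)) Q → HasLabel (s i) X →
  ¬ SameRatio X (P ⊕ Q) → HasLabel (mutated s i z) (P ⊕ Q)
mutated-label {s} i (a , b) (c , d) (e , f) z hP hQ hX ¬same
  with s (other₁ i) | s (other₂ i) | s i
... | pos _ _ _ | pos _ _ _ | pos _ _ _ with hP | hQ | hX
... | refl | refl | refl = newLabel-mediant a b c d e f ¬same

record Farey (i : Fin 3) (s : State) : Set where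
  field
    label      : Fin 3 → Label
    marked     : ∀ k → Marked (s k) (label k)
    mediant    : label i ≡ label (other₁ i) ⊕ label (other₂ i)
    unimodular : Unimodular (label (other₁ i)) (label (other₂ i))

other₁≢ : ∀ i → other₁ i ≢ i
other₁≢ zero             ()
other₁≢ (suc zero)       ()
other₁≢ (suc (suc zero)) ()

other₂≢ : ∀ i → other₂ i ≢ i
other₂≢ zero             ()
other₂≢ (suc zero)       ()
other₂≢ (suc (suc zero)) ()

others-cover : ∀ i k → k ≡ i ⊎ k ≡ other₁ i ⊎ k ≡ other₂ i
others-cover zero             zero             = inj₁ refl
others-cover zero             (suc zero)       = inj₂ (inj₁ refl)
others-cover zero             (suc (suc zero)) = inj₂ (inj₂ refl)
others-cover (suc zero)       zero             = inj₂ (inj₁ refl)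
others-cover (suc zero)       (suc zero)       = inj₁ refl
others-cover (suc zero)       (suc (suc zero)) = inj₂ (inj₂ refl)
others-cover (suc (suc zero)) zero             = inj₂ (inj₁ refl)
others-cover (suc (suc zero)) (suc zero)       = inj₂ (inj₂ refl)
others-cover (suc (suc zero)) (suc (suc zero)) = inj₁ refl

update-pointwise : ∀ (R : Pos → Label → Set) {s Λ} j {p L} → (∀ k → R (s k) (Λ k)) → R p L →
                   ∀ k → R (update s j p k) (updateAt Λ j (const L) k)
update-pointwise R {s} {Λ} j {p} rs r k with k ≟ j
... | yes refl = subst (R p) (sym (updateAt-updates k Λ)) r
... | no k≢j   = subst (R (s k)) (sym (updateAt-minimal k j Λ k≢j)) (rs k)

farey-mediant-comm : ∀ {i s} (f : Farey i s) →
  let open Farey f in label i ≡ label (other₂ i) ⊕ label (other₁ i)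
farey-mediant-comm {i} f = trans mediant (⊕-comm (label (other₁ i)) (label (other₂ i)))
  where open Farey f

farey-neighbours : ∀ {i j s} (f : Farey i s) → j ≢ i →
  let open Farey f in Neighbours (label j) (label (other₁ j)) (label (other₂ j))
farey-neighbours {zero}             {zero}             _ j≢i = contradiction refl j≢i
farey-neighbours {suc zero}         {suc zero}         _ j≢i = contradiction refl j≢i
farey-neighbours {suc (suc zero)}   {suc (suc zero)}   _ j≢i = contradiction refl j≢i
farey-neighbours {zero}             {suc zero}         f _ =
  inj₁ (mediant , unimodular) where open Farey f
farey-neighbours {zero}             {suc (suc zero)}   f _ =
  inj₁ (farey-mediant-comm f , unimodular-sym unimodular) where open Farey f
farey-neighbours {suc zero}         {zero}             f _ =
  inj₁ (mediant , unimodular) where open Farey f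
farey-neighbours {suc zero}         {suc (suc zero)}   f _ =
  inj₂ (farey-mediant-comm f , unimodular-sym unimodular) where open Farey f
farey-neighbours {suc (suc zero)}   {zero}             f _ =
  inj₂ (mediant , unimodular) where open Farey f
farey-neighbours {suc (suc zero)}   {suc zero}         f _ =
  inj₂ (farey-mediant-comm f , unimodular-sym unimodular) where open Farey f

farey-step : ∀ {i j s s'} → Farey i s → j ≢ i → Mut j s s' → Farey j s'
farey-step {i} {j} {s} f j≢i (mut z' eq) = record
  { label      = label′
  ; marked     = update-pointwise Marked j marked new
  ; mediant    = trans (updateAt-updates j label) (sym (cong₂ _⊕_ unchanged₁ unchanged₂))
  ; unimodular = subst₂ Unimodular (sym unchanged₁) (sym unchanged₂) (neighbours-unimodular nb)
  }
  where
  open Farey f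
  P Q X : Label
  P = label (other₁ j)
  Q = label (other₂ j)
  X = label j
  nb : Neighbours X P Q
  nb = farey-neighbours f j≢i
  new : Marked (mutated s j z') (P ⊕ Q)
  new = mutated-label {s} j P Q X z' (proj₁ (marked (other₁ j))) (proj₁ (marked (other₂ j))) (proj₁ (marked j))
                      (neighbours-¬sameRatio nb)
      , neighbours-number nb (proj₂ (marked (other₁ j))) (proj₂ (marked (other₂ j))) (proj₂ (marked j)) eq
  label′ : Fin 3 → Label
  label′ = updateAt label j (const (P ⊕ Q))
  unchanged₁ : label′ (other₁ j) ≡ P
  unchanged₁ = updateAt-minimal (other₁ j) j label (other₁≢ j)
  unchanged₂ : label′ (other₂ j) ≡ Q
  unchanged₂ = updateAt-minimal (other₂ j) j label (other₂≢ j)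

farey-first : ∀ {s} → Mut (suc (suc zero)) initial s → Farey (suc (suc zero)) s
farey-first (mut z' eq) = record
  { label      = λ { zero → 0 , 1 ; (suc zero) → 1 , 0 ; (suc (suc zero)) → 1 , 1 }
  ; marked     = λ { zero             → refl , has-number-0/1
                   ; (suc zero)       → refl , has-number-1/q refl
                   ; (suc (suc zero)) → refl , has-number-1/q (trans (sym (*-identityʳ z')) eq) }
  ; mediant    = refl
  ; unimodular = det≡-1 refl
  }

farey-reachable : ∀ {i s} → Reach₂ i s → Farey i s
farey-reachable (second μ₁ μ₂)  = farey-step (farey-first μ₁) (λ ()) μ₂
farey-reachable (step r j≢i μ) = farey-step (farey-reachable r) j≢i μ

farey-partner : ∀ {i s} (f : Farey i s) k → let open Farey f in ∃ λ L → Unimodular (label k) L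
farey-partner {i} f k with others-cover i k
... | inj₁ refl        =
  label (other₂ i) , subst (λ L → Unimodular L (label (other₂ i))) (sym mediant) (unimodular-⊕ˡ unimodular)
  where open Farey f
... | inj₂ (inj₁ refl) = _ , unimodular where open Farey f
... | inj₂ (inj₂ refl) = _ , unimodular-sym unimodular where open Farey f

marked-carries : ∀ {p q} L → Marked p L → (∃ λ R → Unimodular L R) →
                 num p ℤ.* + q ≡ den p ℤ.* + 1 → val p ≡ m₁ q
marked-carries {pos _ _ _} {q} (a , b) (refl , nL) (_ , u) e = number-1/q nL q (cong₂ _,_ a≡1 b≡q)
  where
  a*q≡b : a * q ≡ b
  a*q≡b = ℤ.+-injective (trans (ℤ.pos-* a q) (trans e (ℤ.*-identityʳ (+ b))))
  a≡1 : a ≡ 1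
  a≡1 = unimodular⇒numerator-1 a*q≡b u
  b≡q : b ≡ q
  b≡q = trans (sym a*q≡b) (trans (cong (_* q) a≡1) (+-identityʳ q))

farey-carries : ∀ {i s q n} → Farey i s → Carries s 1 q n → n ≡ m₁ q
farey-carries f (k , e , refl) = marked-carries (label k) (marked k) (farey-partner f k) e
  where open Farey f

isMarkov⇒m₁ : ∀ {q n} → IsMarkov 1 q n → n ≡ m₁ q
isMarkov⇒m₁ (inj₁ (_ , μ , c))     = farey-carries (farey-first μ) c
isMarkov⇒m₁ (inj₂ (_ , _ , r , c)) = farey-carries (farey-reachable r) c

-- The ratio m_{1/(q+1)} / m_{1/q}

-- n/D < α and α < n/D, following the case split of BelowAlpha and AboveAlpha
-- with s standing for 2n − 5D.
data BelowAlphaℕ (n D : ℕ) : Set where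
  below-5/2 : 2 * n < 5 * D → BelowAlphaℕ n D
  below-√21 : ∀ s → 2 * n ≡ 5 * D + s → s * s < 21 * (D * D) → BelowAlphaℕ n D

AboveAlphaℕ : ℕ → ℕ → Set
AboveAlphaℕ n D = ∃ λ s → 2 * n ≡ 5 * D + s × 21 * (D * D) < s * s

m*m<n*n⇒m<n : ∀ {m n} → m * m < n * n → m < n
m*m<n*n⇒m<n m*m<n*n = ≰⇒> (λ n≤m → <⇒≱ m*m<n*n (*-mono-≤ n≤m n≤m))

split-scaled : ∀ x y z k → 2 * x ≡ 5 * y + z → 2 * (x * k) ≡ 5 * (y * k) + z * k
split-scaled x y z k e = begin
  2 * (x * k)         ≡⟨ *-assoc 2 x k ⟨
  2 * x * k           ≡⟨ cong (_* k) e ⟩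
  (5 * y + z) * k     ≡⟨ *-distribʳ-+ k (5 * y) z ⟩
  5 * y * k + z * k   ≡⟨ cong (_+ z * k) (*-assoc 5 y k) ⟩
  5 * (y * k) + z * k ∎
  where open ≡-Reasoning

markovPair⇒<5* : ∀ {a b} → MarkovPair a b → b < 5 * a
markovPair⇒<5* {a} {b} markov = *-cancelʳ-< b b (5 * a) (begin-strict
  b * b                         <⟨ m<m+n (b * b) (s≤s z≤n) ⟩
  b * b + suc (a * a + a + b)   ≡⟨ regroup a b ⟩
  a * a + b * b + 1 + a + b     ≡⟨ markov ⟩
  5 * (a * b)                   ≡⟨ *-assoc 5 a b ⟨
  5 * a * b                     ∎)
  where
  open ≤-Reasoning
  regroup : ∀ a b → b * b + suc (a * a + a + b) ≡ a * a + b * b + 1 + a + b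
  regroup = solve-∀

markovPair-discriminant : ∀ {a b W} → MarkovPair a b → 2 * b ≡ 5 * a + W →
                          W * W + 4 * (1 + a + b) ≡ 21 * (a * a)
markovPair-discriminant {a} {b} {W} markov 2b≡5a+W =
  +-cancelˡ-≡ (29 * (a * a) + 10 * (a * W)) (W * W + 4 * (1 + a + b)) (21 * (a * a)) (begin
    29 * (a * a) + 10 * (a * W) + (W * W + 4 * (1 + a + b))   ≡⟨ complete-square a b W ⟩
    4 * (a * a) + (5 * a + W) * (5 * a + W) + 4 * (1 + a + b) ≡⟨ cong (λ t → 4 * (a * a) + t * t + 4 * (1 + a + b)) 2b≡5a+W ⟨
    4 * (a * a) + 2 * b * (2 * b) + 4 * (1 + a + b)           ≡⟨ factor-4 a b ⟩
    4 * (a * a + b * b + 1 + a + b)                           ≡⟨ cong (4 *_) markov ⟩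
    4 * (5 * (a * b))                                         ≡⟨ factor-10 a b ⟩
    10 * a * (2 * b)                                          ≡⟨ cong (10 * a *_) 2b≡5a+W ⟩
    10 * a * (5 * a + W)                                      ≡⟨ expand a W ⟩
    29 * (a * a) + 10 * (a * W) + 21 * (a * a)               ∎)
  where
  open ≡-Reasoning
  complete-square : ∀ a b W → 29 * (a * a) + 10 * (a * W) + (W * W + 4 * (1 + a + b))
                            ≡ 4 * (a * a) + (5 * a + W) * (5 * a + W) + 4 * (1 + a + b)
  complete-square = solve-∀
  factor-4 : ∀ a b → 4 * (a * a) + 2 * b * (2 * b) + 4 * (1 + a + b) ≡ 4 * (a * a + b * b + 1 + a + b)
  factor-4 = solve-∀
  factor-10 : ∀ a b → 4 * (5 * (a * b)) ≡ 10 * a * (2 * b)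
  factor-10 = solve-∀
  expand : ∀ a W → 10 * a * (5 * a + W) ≡ 29 * (a * a) + 10 * (a * W) + 21 * (a * a)
  expand = solve-∀

markovPair-discriminant-scaled : ∀ {a b W} → MarkovPair a b → 2 * b ≡ 5 * a + W → ∀ D →
  W * D * (W * D) + 4 * (1 + a + b) * (D * D) ≡ 21 * (D * D) * (a * a)
markovPair-discriminant-scaled {a} {b} {W} markov 2b≡5a+W D = begin
  W * D * (W * D) + 4 * (1 + a + b) * (D * D) ≡⟨ factor a b W D ⟩
  (W * W + 4 * (1 + a + b)) * (D * D)         ≡⟨ cong (_* (D * D)) (markovPair-discriminant {a} {b} markov 2b≡5a+W) ⟩
  21 * (a * a) * (D * D)                      ≡⟨ reorder a D ⟩
  21 * (D * D) * (a * a)                      ∎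
  where
  open ≡-Reasoning
  factor : ∀ a b W D → W * D * (W * D) + 4 * (1 + a + b) * (D * D) ≡ (W * W + 4 * (1 + a + b)) * (D * D)
  factor = solve-∀
  reorder : ∀ a D → 21 * (a * a) * (D * D) ≡ 21 * (D * D) * (a * a)
  reorder = solve-∀

markovPair-error<a² : ∀ {a b} D .{{_ : NonZero a}} → MarkovPair a b → 28 * (D * D) < a →
                      4 * (1 + a + b) * (D * D) < a * a
markovPair-error<a² {a} {b} D markov 28D²<a = begin-strict
  4 * (1 + a + b) * (D * D) ≤⟨ *-monoˡ-≤ (D * D) (*-monoʳ-≤ 4 1+a+b≤7a) ⟩
  4 * (7 * a) * (D * D)     ≡⟨ reorder a D ⟩
  28 * (D * D) * a          <⟨ *-monoˡ-< a 28D²<a ⟩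
  a * a                     ∎
  where
  open ≤-Reasoning
  1+a+b≤7a : 1 + a + b ≤ 7 * a
  1+a+b≤7a = begin
    1 + a + b     ≤⟨ +-mono-≤ (+-monoˡ-≤ a (>-nonZero⁻¹ a)) (<⇒≤ (markovPair⇒<5* {a} markov)) ⟩
    a + a + 5 * a ≡⟨ collect a ⟩
    7 * a         ∎
    where
    collect : ∀ a → a + a + 5 * a ≡ 7 * a
    collect = solve-∀
  reorder : ∀ a D → 4 * (7 * a) * (D * D) ≡ 28 * (D * D) * a
  reorder = solve-∀

-- (W D)² falls short of 21D²a² by 4(1 + a + b)D², which 28D² < a keeps below a², while
-- (s a)² falls short of it by at least a².
below-alpha-bound : ∀ {n D a b} .{{_ : NonZero a}} → BelowAlphaℕ n D → MarkovPair a b →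
                    5 * a ≤ 2 * b → 28 * (D * D) < a → n * a < b * D
below-alpha-bound {n} {D} {a} {b} (below-5/2 2n<5D) _ 5a≤2b _ =
  *-cancelˡ-< 2 (n * a) (b * D) (begin-strict
    2 * (n * a) ≡⟨ *-assoc 2 n a ⟨
    2 * n * a   <⟨ *-monoˡ-< a 2n<5D ⟩
    5 * D * a   ≡⟨ reorder D a ⟩
    5 * a * D   ≤⟨ *-monoˡ-≤ D 5a≤2b ⟩
    2 * b * D   ≡⟨ *-assoc 2 b D ⟩
    2 * (b * D) ∎)
  where
  open ≤-Reasoning
  reorder : ∀ D a → 5 * D * a ≡ 5 * a * D
  reorder = solve-∀
below-alpha-bound {n} {D} {a} {b} (below-√21 s 2n≡5D+s s²<21D²) markov 5a≤2b 28D²<a =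
  *-cancelˡ-< 2 (n * a) (b * D) (begin-strict
    2 * (n * a)         ≡⟨ split-scaled n D s a 2n≡5D+s ⟩
    5 * (D * a) + s * a <⟨ +-monoʳ-< (5 * (D * a)) sa<WD ⟩
    5 * (D * a) + W * D ≡⟨ cong (λ t → 5 * t + W * D) (*-comm D a) ⟩
    5 * (a * D) + W * D ≡⟨ split-scaled b a W D 2b≡5a+W ⟨
    2 * (b * D)         ∎)
  where
  open ≤-Reasoning
  W : ℕ
  W = 2 * b ∸ 5 * a
  2b≡5a+W : 2 * b ≡ 5 * a + W
  2b≡5a+W = sym (m+[n∸m]≡n 5a≤2b)
  sa<WD : s * a < W * D
  sa<WD = m*m<n*n⇒m<n (+-cancelʳ-< (a * a) (s * a * (s * a)) (W * D * (W * D)) (begin-strict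
    s * a * (s * a) + a * a                     ≡⟨ factor s a ⟩
    suc (s * s) * (a * a)                       ≤⟨ *-monoˡ-≤ (a * a) s²<21D² ⟩
    21 * (D * D) * (a * a)                      ≡⟨ markovPair-discriminant-scaled {a} {b} markov 2b≡5a+W D ⟨
    W * D * (W * D) + 4 * (1 + a + b) * (D * D) <⟨ +-monoʳ-< (W * D * (W * D)) (markovPair-error<a² D markov 28D²<a) ⟩
    W * D * (W * D) + a * a                     ∎))
    where
    factor : ∀ s a → s * a * (s * a) + a * a ≡ suc (s * s) * (a * a)
    factor = solve-∀

above-alpha-bound : ∀ {n D a b} .{{_ : NonZero a}} → AboveAlphaℕ n D → MarkovPair a b →
                    5 * a ≤ 2 * b → b * D < n * a
above-alpha-bound {n} {D} {a} {b} (s , 2n≡5D+s , 21D²<s²) markov 5a≤2b =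
  *-cancelˡ-< 2 (b * D) (n * a) (begin-strict
    2 * (b * D)         ≡⟨ split-scaled b a W D 2b≡5a+W ⟩
    5 * (a * D) + W * D <⟨ +-monoʳ-< (5 * (a * D)) WD<sa ⟩
    5 * (a * D) + s * a ≡⟨ cong (λ t → 5 * t + s * a) (*-comm a D) ⟩
    5 * (D * a) + s * a ≡⟨ split-scaled n D s a 2n≡5D+s ⟨
    2 * (n * a)         ∎)
  where
  open ≤-Reasoning
  instance _ = m*n≢0 a a
  W : ℕ
  W = 2 * b ∸ 5 * a
  2b≡5a+W : 2 * b ≡ 5 * a + W
  2b≡5a+W = sym (m+[n∸m]≡n 5a≤2b)
  WD<sa : W * D < s * a
  WD<sa = m*m<n*n⇒m<n (begin-strict
    W * D * (W * D)                             ≤⟨ m≤m+n (W * D * (W * D)) _ ⟩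
    W * D * (W * D) + 4 * (1 + a + b) * (D * D) ≡⟨ markovPair-discriminant-scaled {a} {b} markov 2b≡5a+W D ⟩
    21 * (D * D) * (a * a)                      <⟨ *-monoˡ-< (a * a) 21D²<s² ⟩
    s * s * (a * a)                             ≡⟨ regroup s a ⟩
    s * a * (s * a)                             ∎)
    where
    regroup : ∀ s a → s * s * (a * a) ≡ s * a * (s * a)
    regroup = solve-∀

-- Rational comparisons

toℚᵘ-*fromℕ : ∀ r a → toℚᵘ (r ℚ.* fromℕ a) ≃ᵘ toℚᵘ r ℚᵘ.* mkℚᵘ (+ a) 0
toℚᵘ-*fromℕ r a = ℚᵘ.≃-trans (ℚ.toℚᵘ-homo-* r (fromℕ a)) (ℚᵘ.*-congˡ {toℚᵘ r} (ℚ.toℚᵘ-fromℚᵘ (mkℚᵘ (+ a) 0)))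

*fromℕ<fromℕ : ∀ r a b → ↥ r ℤ.* + a ℤ.< + b ℤ.* ↧ r → r ℚ.* fromℕ a ℚ.< fromℕ b
*fromℕ<fromℕ r@(mkℚ _ dm _) a b h = ℚ.toℚᵘ-cancel-<
  (ℚᵘ.<-respˡ-≃ (ℚᵘ.≃-sym (toℚᵘ-*fromℕ r a))
    (ℚᵘ.<-respʳ-≃ (ℚᵘ.≃-sym (ℚ.toℚᵘ-fromℚᵘ (mkℚᵘ (+ b) 0)))
      (*<* (subst₂ ℤ._<_ (sym (ℤ.*-identityʳ _)) (cong (λ d → + b ℤ.* + d) (sym (*-identityʳ (suc dm)))) h))))

fromℕ<*fromℕ : ∀ r a b → + b ℤ.* ↧ r ℤ.< ↥ r ℤ.* + a → fromℕ b ℚ.< r ℚ.* fromℕ a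
fromℕ<*fromℕ r@(mkℚ _ dm _) a b h = ℚ.toℚᵘ-cancel-<
  (ℚᵘ.<-respʳ-≃ (ℚᵘ.≃-sym (toℚᵘ-*fromℕ r a))
    (ℚᵘ.<-respˡ-≃ (ℚᵘ.≃-sym (ℚ.toℚᵘ-fromℚᵘ (mkℚᵘ (+ b) 0)))
      (*<* (subst₂ ℤ._<_ (cong (λ d → + b ℤ.* + d) (sym (*-identityʳ (suc dm)))) (sym (ℤ.*-identityʳ _)) h))))

σ : ℚ → ℤ
σ r = + 2 ℤ.* ↥ r ℤ.- + 5 ℤ.* ↧ r

toℚᵘ-2r-5 : ∀ r → toℚᵘ (ℚ2 ℚ.* r ℚ.- ℚ5) ≃ᵘ mkℚᵘ (σ r) (pred (↧ₙ r))
toℚᵘ-2r-5 r@(mkℚ n dm _) = ℚᵘ.≃-trans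
  (ℚᵘ.≃-trans (ℚ.toℚᵘ-homo-+ (ℚ2 ℚ.* r) (ℚ.- ℚ5)) (ℚᵘ.+-cong (ℚ.toℚᵘ-homo-* ℚ2 r) (ℚ.toℚᵘ-homo‿- ℚ5)))
  (*≡* (cong₂ ℤ._*_ numerator≡ (sym denominator≡)))
  where
  t : ℚᵘ
  t = mkℚᵘ (+ 2) 0 ℚᵘ.* mkℚᵘ n dm ℚᵘ.+ mkℚᵘ (ℤ.- + 5) 0
  numerator≡ : ℚᵘ.↥ t ≡ σ r
  numerator≡ = trans (cong (λ d → + 2 ℤ.* n ℤ.* + 1 ℤ.+ ℤ.- + 5 ℤ.* + suc d) (+-identityʳ dm))
                     (lemma n (+ suc dm))
    where
    lemma : ∀ n D → + 2 ℤ.* n ℤ.* + 1 ℤ.+ ℤ.- + 5 ℤ.* D ≡ + 2 ℤ.* n ℤ.- + 5 ℤ.* D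
    lemma = ℤ-solve-∀
  denominator≡ : ℚᵘ.↧ t ≡ + suc dm
  denominator≡ = cong (λ d → + suc d) (trans (*-identityʳ (dm + 0)) (+-identityʳ dm))

toℚᵘ-[2r-5]² : ∀ r → toℚᵘ ((ℚ2 ℚ.* r ℚ.- ℚ5) ℚ.* (ℚ2 ℚ.* r ℚ.- ℚ5)) ≃ᵘ mkℚᵘ (σ r) (pred (↧ₙ r)) ℚᵘ.* mkℚᵘ (σ r) (pred (↧ₙ r))
toℚᵘ-[2r-5]² r = ℚᵘ.≃-trans (ℚ.toℚᵘ-homo-* (ℚ2 ℚ.* r ℚ.- ℚ5) (ℚ2 ℚ.* r ℚ.- ℚ5)) (ℚᵘ.*-cong (toℚᵘ-2r-5 r) (toℚᵘ-2r-5 r))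

belowAlpha⇒σ : ∀ r → BelowAlpha r → σ r ℤ.< 0ℤ ⊎ σ r ℤ.* σ r ℤ.< + 21 ℤ.* (↧ r ℤ.* ↧ r)
belowAlpha⇒σ r@(mkℚ _ _ _) (inj₁ t<0) =
  inj₁ (subst (ℤ._< 0ℤ) (ℤ.*-identityʳ (σ r)) (ℚᵘ.drop-*<* (ℚᵘ.<-respˡ-≃ (toℚᵘ-2r-5 r) (ℚ.toℚᵘ-mono-< t<0))))
belowAlpha⇒σ r@(mkℚ _ _ _) (inj₂ t²<21) =
  inj₂ (subst (ℤ._< _) (ℤ.*-identityʳ (σ r ℤ.* σ r)) (ℚᵘ.drop-*<* (ℚᵘ.<-respˡ-≃ (toℚᵘ-[2r-5]² r) (ℚ.toℚᵘ-mono-< t²<21))))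

aboveAlpha⇒σ : ∀ r → AboveAlpha r → 0ℤ ℤ.≤ σ r × + 21 ℤ.* (↧ r ℤ.* ↧ r) ℤ.< σ r ℤ.* σ r
aboveAlpha⇒σ r@(mkℚ _ _ _) (0≤t , 21<t²) =
  subst (0ℤ ℤ.≤_) (ℤ.*-identityʳ (σ r)) (ℚᵘ.drop-*≤* (ℚᵘ.≤-respʳ-≃ (toℚᵘ-2r-5 r) (ℚ.toℚᵘ-mono-≤ 0≤t))) ,
  subst (_ ℤ.<_) (ℤ.*-identityʳ (σ r ℤ.* σ r)) (ℚᵘ.drop-*<* (ℚᵘ.<-respʳ-≃ (toℚᵘ-[2r-5]² r) (ℚ.toℚᵘ-mono-< 21<t²)))

+*+<+*+ : ∀ a b c d → a * b < c * d → + a ℤ.* + b ℤ.< + c ℤ.* + d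
+*+<+*+ a b c d h = subst₂ ℤ._<_ (ℤ.pos-* a b) (ℤ.pos-* c d) (ℤ.+<+ h)

+*+<+*+⁻¹ : ∀ a b c d → + a ℤ.* + b ℤ.< + c ℤ.* + d → a * b < c * d
+*+<+*+⁻¹ a b c d h = ℤ.drop‿+<+ (subst₂ ℤ._<_ (sym (ℤ.pos-* a b)) (sym (ℤ.pos-* c d)) h)

⊖-cases : ∀ m k → (m < k × m ℤ.⊖ k ℤ.< 0ℤ) ⊎ ∃ λ s → m ≡ k + s × m ℤ.⊖ k ≡ + s
⊖-cases m k with m <? k
... | yes m<k = inj₁ (m<k , subst (m ℤ.⊖ k ℤ.<_) (ℤ.n⊖n≡0 k) (ℤ.⊖-monoˡ-< k m<k))
... | no m≮k  = inj₂ (m ∸ k , sym (m+[n∸m]≡n (≮⇒≥ m≮k)) , ℤ.⊖-≥ (≮⇒≥ m≮k))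

σ≡⊖ : ∀ r {n} → ↥ r ≡ + n → σ r ≡ (2 * n) ℤ.⊖ (5 * ↧ₙ r)
σ≡⊖ (mkℚ _ dm _) {n} refl =
  trans (cong₂ ℤ._-_ (sym (ℤ.pos-* 2 n)) (sym (ℤ.pos-* 5 (suc dm)))) (ℤ.[+m]-[+n]≡m⊖n (2 * n) (5 * suc dm))

belowAlpha⇒ℕ : ∀ r {n} → ↥ r ≡ + n → BelowAlpha r → BelowAlphaℕ n (↧ₙ r)
belowAlpha⇒ℕ r {n} ↥r≡n l<α with ⊖-cases (2 * n) (5 * ↧ₙ r) | belowAlpha⇒σ r l<α
... | inj₁ (2n<5D , _)   | _        = below-5/2 2n<5D
... | inj₂ (s , _ , ⊖≡s) | inj₁ σ<0 with subst (ℤ._< 0ℤ) (trans (σ≡⊖ r ↥r≡n) ⊖≡s) σ<0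
...   | ℤ.+<+ ()
belowAlpha⇒ℕ r {n} ↥r≡n l<α | inj₂ (s , 2n≡5D+s , ⊖≡s) | inj₂ σ²<21D² =
  below-√21 s 2n≡5D+s (+*+<+*+⁻¹ s s 21 (D * D) (subst₂ ℤ._<_ σ²≡ (cong (+ 21 ℤ.*_) (sym (ℤ.pos-* D D))) σ²<21D²))
  where
  D : ℕ
  D = ↧ₙ r
  σ²≡ : σ r ℤ.* σ r ≡ + s ℤ.* + s
  σ²≡ = cong (λ t → t ℤ.* t) (trans (σ≡⊖ r ↥r≡n) ⊖≡s)

aboveAlpha⇒ℕ : ∀ r {n} → ↥ r ≡ + n → AboveAlpha r → AboveAlphaℕ n (↧ₙ r)
aboveAlpha⇒ℕ r {n} ↥r≡n α<r with ⊖-cases (2 * n) (5 * ↧ₙ r) | aboveAlpha⇒σ r α<r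
... | inj₁ (_ , ⊖<0) | 0≤σ , _ = ⊥-elim (ℤ.<⇒≱ (subst (ℤ._< 0ℤ) (sym (σ≡⊖ r ↥r≡n)) ⊖<0) 0≤σ)
... | inj₂ (s , 2n≡5D+s , ⊖≡s) | _ , 21D²<σ² =
  s , 2n≡5D+s , +*+<+*+⁻¹ 21 (D * D) s s (subst₂ ℤ._<_ (cong (+ 21 ℤ.*_) (sym (ℤ.pos-* D D))) σ²≡ 21D²<σ²)
  where
  D : ℕ
  D = ↧ₙ r
  σ²≡ : σ r ℤ.* σ r ≡ + s ℤ.* + s
  σ²≡ = cong (λ t → t ℤ.* t) (trans (σ≡⊖ r ↥r≡n) ⊖≡s)

ratio-above : ∀ l → BelowAlpha l → ∀ q → 28 * (↧ₙ l * ↧ₙ l) ≤ q →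
              l ℚ.* fromℕ (m₁ q) ℚ.< fromℕ (m₁ (suc q))
ratio-above l@(mkℚ -[1+ _ ] _ _) _ q _ = *fromℕ<fromℕ l (m₁ q) (m₁ (suc q)) ℤ.-<+
ratio-above l@(mkℚ (+ n) dm _) l<α q N≤q =
  *fromℕ<fromℕ l (m₁ q) (m₁ (suc q)) (+*+<+*+ n (m₁ q) (m₁ (suc q)) (suc dm)
    (below-alpha-bound {n} {suc dm} {m₁ q} {m₁ (suc q)} (belowAlpha⇒ℕ l refl l<α)
       (m₁-markovPair q) (m₁-ratio≥5/2 q) (≤-<-trans N≤q (q<m₁ q))))

ratio-below : ∀ u → AboveAlpha u → ∀ q → fromℕ (m₁ (suc q)) ℚ.< u ℚ.* fromℕ (m₁ q)
ratio-below u@(mkℚ -[1+ _ ] _ _) α<u with proj₁ (aboveAlpha⇒σ u α<u)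
... | ()
ratio-below u@(mkℚ (+ n) dm _) α<u q =
  fromℕ<*fromℕ u (m₁ q) (m₁ (suc q)) (+*+<+*+ (m₁ (suc q)) (suc dm) n (m₁ q)
    (above-alpha-bound {n} {suc dm} {m₁ q} {m₁ (suc q)} (aboveAlpha⇒ℕ u refl α<u)
       (m₁-markovPair q) (m₁-ratio≥5/2 q)))

proposition4p7 : (m : ℕ → ℕ) → (∀ q → 1 ≤ q → IsMarkov 1 q (m q)) →
    ∀ (l u : ℚ) → BelowAlpha l → AboveAlpha u →
    ∃ λ N → ∀ q → N ≤ q → 1 ≤ q →
      (l ℚ.* fromℕ (m q) ℚ.< fromℕ (m (suc q))) × (fromℕ (m (suc q)) ℚ.< u ℚ.* fromℕ (m q))
proposition4p7 m markov l u l<α α<u = 28 * (↧ₙ l * ↧ₙ l) , bounds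
  where
  bounds : ∀ q → 28 * (↧ₙ l * ↧ₙ l) ≤ q → 1 ≤ q →
           (l ℚ.* fromℕ (m q) ℚ.< fromℕ (m (suc q))) × (fromℕ (m (suc q)) ℚ.< u ℚ.* fromℕ (m q))
  bounds q N≤q 1≤q rewrite isMarkov⇒m₁ (markov q 1≤q) | isMarkov⇒m₁ (markov (suc q) (s≤s z≤n)) =
    ratio-above l l<α q N≤q , ratio-below u α<u q
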